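{- Let $n\ge 1$, $N=2^n$, and for $i\in[1..2N]$ let $R_{N,i}$ be the $i$-th row of $\mathsf{ShiftBin}_N$ (a string of length $N(n+2)$). Then every 1D SLP deriving a string that contains $R_{N,i}$ as a substring has size at least $\min\{i, 2N-i+1\}$.
   Context: Alphabet $\{0,1,\$\}$. For $N=2^n$, $\mathsf{Bin}_N$ is the $N\times(n+2)$ 2D string whose $i$-th row ($i\in[1..N]$) is $\$$, followed by the $n$-bit binary representation of $i-1$ (most significant bit first), followed by $\$$. $\mathsf{ShiftBin}_N$ is the $2N\times N(n+2)$ 2D string such that for every $j\in[0..N-1]$, the substring in rows $j+1,\dots,j+N$ and columns $j(n+2)+1,\dots,(j+1)(n+2)$ equals $\mathsf{Bin}_N$, and all other entries are $0$. A 1D SLP is a context-free grammar deriving exactly one string, in which every nonterminal has one production whose right-hand side is either a single character or the concatenation $YZ$ of two nonterminals, with acyclic dependency; its size is the total number of symbols on the right-hand sides of all productions. -}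

module Defs where

open import Data.Nat using (ℕ; zero; suc; _+_; _*_; _∸_; _^_; _<ᵇ_; _%_; _/_)
open import Data.Bool using (Bool; true; false; if_then_else_; _∧_)
open import Data.List using (List; []; _∷_; _++_; [_]; concatMap; upTo; replicate)
open import Data.Vec using (Vec; []; _∷ʳ_; lookup)
open import Data.Fin using (Fin; fromℕ)
open import Data.Product using (∃₂)
open import Relation.Binary.PropositionalEquality using (_≡_)

data Sym : Set where
  s0 s1 s$ : Sym

bitSym : ℕ → Sym
bitSym 0 = s0
bitSym _ = s1

bits : ℕ → ℕ → List Sym
bits zero    v = []
bits (suc m) v = bits m (v / 2) ++ [ bitSym (v % 2) ]

-- Row of Bin_N encoding the value v (= i-1): $ bits $
binRow : ℕ → ℕ → List Sym
binRow n v = s$ ∷ bits n v ++ [ s$ ]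

-- Block j (0-based) of row i (1-based) of ShiftBin_N, N = 2^n:
-- equals row i-j of Bin_N if j < i ≤ j+N, otherwise all zeros.
shiftBinBlock : ℕ → ℕ → ℕ → List Sym
shiftBinBlock n i j =
  if (j <ᵇ i) ∧ (i <ᵇ suc (j + 2 ^ n))
  then binRow n (i ∸ j ∸ 1)
  else replicate (n + 2) s0

-- R_{N,i}: the i-th row (1-based) of ShiftBin_N, a string of length N(n+2)
shiftBinRow : ℕ → ℕ → List Sym
shiftBinRow n i = concatMap (shiftBinBlock n i) (upTo (2 ^ n))

-- 1D straight-line programs.  Nonterminals are numbered 0,1,...;
-- the rule of nonterminal k may only refer to nonterminals < k (acyclicity).
data Rule (k : ℕ) : Set where
  term : Sym → Rule k
  pair : Fin k → Fin k → Rule k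

data SLP : ℕ → Set where
  []  : SLP 0
  _▷_ : ∀ {k} → SLP k → Rule k → SLP (suc k)

evalRule : ∀ {k} → Vec (List Sym) k → Rule k → List Sym
evalRule e (term a)   = [ a ]
evalRule e (pair y z) = lookup e y ++ lookup e z

expansions : ∀ {k} → SLP k → Vec (List Sym) k
expansions []      = []
expansions (g ▷ r) = expansions g ∷ʳ evalRule (expansions g) r

-- the derived string: expansion of the start symbol (the last nonterminal)
derived : ∀ {m} → SLP (suc m) → List Sym
derived {m} g = lookup (expansions g) (fromℕ m)

ruleSize : ∀ {k} → Rule k → ℕ
ruleSize (term _)   = 1
ruleSize (pair _ _) = 2

size : ∀ {k} → SLP k → ℕ
size []      = 0
size (g ▷ r) = size g + ruleSize r

_⊑_ : List Sym → List Sym → Set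
u ⊑ w = ∃₂ λ (p s : List Sym) → p ++ u ++ s ≡ w

{-# OPTIONS --safe #-}
-- Follow a factor of length at least 2 of the derived string down the derivation tree: it ends
-- up straddling the junction of some binary rule X → Y Z.  If the factor is $w$ with w free of $,
-- then w is the part of exp(Y) after its last $ followed by the part of exp(Z) before its first $,
-- so distinct such words straddle distinct binary rules.  Row i of ShiftBin_N contains $bin(v)$
-- for the min(i, 2N - i) values v ∈ [i - N, min(i, N)), and the first nonterminal of any SLP has a
-- terminal rule, so the SLP has more than min(i, 2N - i) nonterminals.
module Submission where

open import Defs
open import Data.Nat using (ℕ; zero; suc; _+_; _*_; _∸_; _^_; _≤_; _<_; _⊓_; _<ᵇ_; _%_; _/_; z≤n; s≤s)
open import Data.Nat.Properties
open import Data.Nat.DivMod using (m≡m%n+[m/n]*n; m%n<n; m<n*o⇒m/o<n)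
open import Data.List using (List; []; _∷_; _++_; [_]; _∷ʳ_; length; foldl; reverse; concatMap; initLast; _∷ʳ′_)
open import Data.List.Properties using (∷-injective; ∷ʳ-injective; ∷ʳ-++; ++-assoc; ++-conicalʳ; foldl-++; reverse-++; unfold-reverse; reverse-involutive; length-++-≤ˡ; length-++-≤ʳ; length-++)
open import Data.List.Membership.Propositional using (_∈_; _∉_)
open import Data.List.Membership.Propositional.Properties using (∈-upTo⁺; ∈-++⁺ˡ; ∈-++⁺ʳ; ∈-++⁻)
open import Data.List.Relation.Unary.Any using (here; there)
open import Data.List.Relation.Unary.Any.Properties using (reverse⁻)
open import Data.Vec using (Vec; lookup) renaming ([] to []ᵥ; _∷_ to _∷ᵥ_; _∷ʳ_ to _∷ʳᵥ_)
open import Data.Fin using (Fin; zero; suc; fromℕ; inject₁; toℕ; punchOut)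
open import Data.Fin.Properties using (toℕ<n; toℕ-injective; punchOut-injective; injective⇒≤)
open import Data.Fin.Relation.Unary.Top using (view; ‵fromℕ; ‵inject₁)
open import Data.Product using (Σ; ∃; _×_; _,_; proj₁; proj₂; uncurry)
open import Data.Sum using (_⊎_; inj₁; inj₂)
open import Data.Bool using (true)
open import Function using (Injective; _∘_)
open import Relation.Nullary using (¬_; contradiction)
open import Relation.Binary.PropositionalEquality using (_≡_; _≢_; refl; sym; trans; cong; cong₂; subst; module ≡-Reasoning)

private
  variable
    k : ℕ
    u w A B : List Sym

⊑-trans : ∀ {u v w : List Sym} → u ⊑ v → v ⊑ w → u ⊑ w
⊑-trans {u} (p , s , refl) (p′ , s′ , refl) = p′ ++ p , s ++ s′ , (begin
  (p′ ++ p) ++ u ++ s ++ s′   ≡⟨ ++-assoc p′ p _ ⟩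
  p′ ++ p ++ u ++ s ++ s′     ≡⟨ cong (λ x → p′ ++ p ++ x) (sym (++-assoc u s s′)) ⟩
  p′ ++ p ++ (u ++ s) ++ s′   ≡⟨ cong (p′ ++_) (sym (++-assoc p (u ++ s) s′)) ⟩
  p′ ++ (p ++ u ++ s) ++ s′   ∎)
  where open ≡-Reasoning

⊑⇒length≤ : u ⊑ w → length u ≤ length w
⊑⇒length≤ {u} (p , s , refl) = ≤-trans (length-++-≤ˡ u) (length-++-≤ʳ (u ++ s) {p})

∈⇒⊑-concatMap : ∀ {X : Set} (f : X → List Sym) {x xs} → x ∈ xs → f x ⊑ concatMap f xs
∈⇒⊑-concatMap f {xs = _ ∷ ys} (here refl) = [] , concatMap f ys , refl
∈⇒⊑-concatMap f {xs = y ∷ _} (there x∈ys) with ∈⇒⊑-concatMap f x∈ys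
... | p , s , eq = f y ++ p , s , trans (++-assoc (f y) p _) (cong (f y ++_) eq)

record Straddles (u A B : List Sym) : Set where
  constructor straddles
  field
    p a b s : List Sym
    A≡p++a  : A ≡ p ++ a
    B≡b++s  : B ≡ b ++ s
    u≡a++b  : u ≡ a ++ b
    a≢[]    : a ≢ []
    b≢[]    : b ≢ []

straddles-∷ˡ : ∀ c → Straddles u A B → Straddles u (c ∷ A) B
straddles-∷ˡ c (straddles p a b s refl B≡ u≡ a≢ b≢) = straddles (c ∷ p) a b s refl B≡ u≡ a≢ b≢

¬straddles-[]ˡ : ¬ Straddles u [] B
¬straddles-[]ˡ (straddles p a b s []≡ _ _ a≢ _) = a≢ (++-conicalʳ p a (sym []≡))

prefix-or-overhang : ∀ (u s A B : List Sym) → u ++ s ≡ A ++ B →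
  (∃ λ t → u ++ t ≡ A) ⊎ (∃ λ b → b ≢ [] × u ≡ A ++ b × B ≡ b ++ s)
prefix-or-overhang [] s A B eq = inj₁ (A , refl)
prefix-or-overhang (x ∷ u) s [] B eq = inj₂ (x ∷ u , (λ ()) , refl , sym eq)
prefix-or-overhang (x ∷ u) s (y ∷ A) B eq with ∷-injective eq
... | refl , eq′ with prefix-or-overhang u s A B eq′
... | inj₁ (t , u++t≡A) = inj₁ (t , cong (x ∷_) u++t≡A)
... | inj₂ (b , b≢ , u≡ , B≡) = inj₂ (b , b≢ , cong (x ∷_) u≡ , B≡)

factor-of-++ : ∀ (p s A B : List Sym) → p ++ u ++ s ≡ A ++ B → u ⊑ A ⊎ u ⊑ B ⊎ Straddles u A B
factor-of-++ p s [] B eq = inj₂ (inj₁ (p , s , eq))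
factor-of-++ (_ ∷ p) s (c ∷ A) B eq with ∷-injective eq
... | refl , eq′ with factor-of-++ p s A B eq′
... | inj₁ (p′ , s′ , e) = inj₁ (c ∷ p′ , s′ , cong (c ∷_) e)
... | inj₂ (inj₁ u⊑B) = inj₂ (inj₁ u⊑B)
... | inj₂ (inj₂ st) = inj₂ (inj₂ (straddles-∷ˡ c st))
factor-of-++ {u} [] s (c ∷ A) B eq with prefix-or-overhang u s (c ∷ A) B eq
... | inj₁ (t , e) = inj₁ ([] , t , e)
... | inj₂ (b , b≢ , u≡ , B≡) = inj₂ (inj₂ (straddles [] (c ∷ A) b s refl B≡ u≡ (λ ()) b≢))

frame : List Sym → List Sym
frame w = s$ ∷ w ++ [ s$ ]

2≤length-frame : ∀ w → 2 ≤ length (frame w)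
2≤length-frame w = s≤s (subst (1 ≤_) (sym (length-++ w)) (m≤n+m 1 (length w)))

beforeFirst$ : List Sym → List Sym
beforeFirst$ []       = []
beforeFirst$ (s0 ∷ w) = s0 ∷ beforeFirst$ w
beforeFirst$ (s1 ∷ w) = s1 ∷ beforeFirst$ w
beforeFirst$ (s$ ∷ w) = []

afterLast$ : List Sym → List Sym
afterLast$ w = reverse (beforeFirst$ (reverse w))

beforeFirst$-++-$∷ : ∀ w {s} → s$ ∉ w → beforeFirst$ (w ++ s$ ∷ s) ≡ w
beforeFirst$-++-$∷ []       _   = refl
beforeFirst$-++-$∷ (s0 ∷ w) s$∉ = cong (s0 ∷_) (beforeFirst$-++-$∷ w (s$∉ ∘ there))
beforeFirst$-++-$∷ (s1 ∷ w) s$∉ = cong (s1 ∷_) (beforeFirst$-++-$∷ w (s$∉ ∘ there))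
beforeFirst$-++-$∷ (s$ ∷ w) s$∉ = contradiction (here refl) s$∉

afterLast$-++-$∷ : ∀ p {a} → s$ ∉ a → afterLast$ (p ++ s$ ∷ a) ≡ a
afterLast$-++-$∷ p {a} s$∉a = begin
  reverse (beforeFirst$ (reverse (p ++ s$ ∷ a)))
    ≡⟨ cong (reverse ∘ beforeFirst$) reverse-split ⟩
  reverse (beforeFirst$ (reverse a ++ s$ ∷ reverse p))
    ≡⟨ cong reverse (beforeFirst$-++-$∷ (reverse a) (s$∉a ∘ reverse⁻)) ⟩
  reverse (reverse a)
    ≡⟨ reverse-involutive a ⟩
  a ∎
  where
  open ≡-Reasoning
  reverse-split : reverse (p ++ s$ ∷ a) ≡ reverse a ++ s$ ∷ reverse p
  reverse-split = begin
    reverse (p ++ s$ ∷ a)           ≡⟨ reverse-++ p (s$ ∷ a) ⟩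
    reverse (s$ ∷ a) ++ reverse p   ≡⟨ cong (_++ reverse p) (unfold-reverse s$ a) ⟩
    reverse a ∷ʳ s$ ++ reverse p    ≡⟨ ∷ʳ-++ (reverse a) s$ (reverse p) ⟩
    reverse a ++ s$ ∷ reverse p     ∎

junctionWord : List Sym × List Sym → List Sym
junctionWord (A , B) = afterLast$ A ++ beforeFirst$ B

straddling-frame-unique : s$ ∉ w → Straddles (frame w) A B → w ≡ junctionWord (A , B)
straddling-frame-unique s$∉w (straddles p [] b s _ _ _ a≢ _) = contradiction refl a≢
straddling-frame-unique {B = B} s$∉w (straddles p (x ∷ a) b s refl B≡ u≡ _ b≢)
  with ∷-injective u≡ | initLast b
... | _ | [] = contradiction refl b≢
... | refl , w∷ʳ$≡ | b₀ ∷ʳ′ y with ∷ʳ-injective _ _ (trans w∷ʳ$≡ (sym (++-assoc a b₀ [ y ])))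
... | refl , refl = sym (cong₂ _++_ tail-of-A head-of-B)
  where
  tail-of-A : afterLast$ (p ++ s$ ∷ a) ≡ a
  tail-of-A = afterLast$-++-$∷ p (s$∉w ∘ ∈-++⁺ˡ)
  head-of-B : beforeFirst$ B ≡ b₀
  head-of-B = trans (cong beforeFirst$ (trans B≡ (∷ʳ-++ b₀ s$ s)))
                    (beforeFirst$-++-$∷ b₀ (s$∉w ∘ ∈-++⁺ʳ a))

lookup-∷ʳ-fromℕ : ∀ {X : Set} (xs : Vec X k) {x} → lookup (xs ∷ʳᵥ x) (fromℕ k) ≡ x
lookup-∷ʳ-fromℕ []ᵥ       = refl
lookup-∷ʳ-fromℕ (_ ∷ᵥ xs) = lookup-∷ʳ-fromℕ xs

lookup-∷ʳ-inject₁ : ∀ {X : Set} (xs : Vec X k) {x} (i : Fin k) →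
  lookup (xs ∷ʳᵥ x) (inject₁ i) ≡ lookup xs i
lookup-∷ʳ-inject₁ (_ ∷ᵥ xs) zero    = refl
lookup-∷ʳ-inject₁ (_ ∷ᵥ xs) (suc i) = lookup-∷ʳ-inject₁ xs i

ruleSplit : Vec (List Sym) k → Rule k → List Sym × List Sym
ruleSplit e (term _)   = [] , []
ruleSplit e (pair y z) = lookup e y , lookup e z

splits : SLP k → Vec (List Sym × List Sym) k
splits []      = []ᵥ
splits (g ▷ r) = splits g ∷ʳᵥ ruleSplit (expansions g) r

Straddled : SLP k → List Sym → Set
Straddled {k} g u = Σ (Fin k) λ y → uncurry (Straddles u) (lookup (splits g) y)

straddled-▷ : (g : SLP k) (r : Rule k) → Straddled g u → Straddled (g ▷ r) u
straddled-▷ {u = u} g r (y , st) =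
  inject₁ y , subst (uncurry (Straddles u)) (sym (lookup-∷ʳ-inject₁ (splits g) y)) st

mutual
  long-factor⇒straddled : (g : SLP k) (x : Fin k) → 2 ≤ length u →
    u ⊑ lookup (expansions g) x → Straddled g u
  long-factor⇒straddled {u = u} (g ▷ r) x 2≤|u| u⊑ with view x
  ... | ‵inject₁ y = straddled-▷ g r
    (long-factor⇒straddled g y 2≤|u| (subst (u ⊑_) (lookup-∷ʳ-inject₁ (expansions g) y) u⊑))
  ... | ‵fromℕ = long-factor-of-rule⇒straddled g r 2≤|u|
    (subst (u ⊑_) (lookup-∷ʳ-fromℕ (expansions g)) u⊑)

  long-factor-of-rule⇒straddled : (g : SLP k) (r : Rule k) → 2 ≤ length u →
    u ⊑ evalRule (expansions g) r → Straddled (g ▷ r) u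
  long-factor-of-rule⇒straddled g (term a) 2≤|u| u⊑ =
    contradiction (≤-trans 2≤|u| (⊑⇒length≤ u⊑)) λ { (s≤s ()) }
  long-factor-of-rule⇒straddled {u = u} g (pair y z) 2≤|u| (p , s , eq)
    with factor-of-++ p s (lookup (expansions g) y) (lookup (expansions g) z) eq
  ... | inj₁ u⊑Y        = straddled-▷ g (pair y z) (long-factor⇒straddled g y 2≤|u| u⊑Y)
  ... | inj₂ (inj₁ u⊑Z) = straddled-▷ g (pair y z) (long-factor⇒straddled g z 2≤|u| u⊑Z)
  ... | inj₂ (inj₂ st)  = fromℕ _ , subst (uncurry (Straddles u)) (sym (lookup-∷ʳ-fromℕ (splits g))) st

splits-zero : (g : SLP (suc k)) → lookup (splits g) zero ≡ ([] , [])
splits-zero ([] ▷ term _)  = refl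
splits-zero ((g ▷ r′) ▷ r) = trans (lookup-∷ʳ-inject₁ (splits (g ▷ r′)) zero) (splits-zero (g ▷ r′))

zero≢straddled : (g : SLP (suc k)) → ((y , _) : Straddled g u) → zero ≢ y
zero≢straddled {u = u} g (y , st) refl =
  ¬straddles-[]ˡ (subst (uncurry (Straddles u)) (splits-zero g) st)

nonterminals≤size : (g : SLP k) → k ≤ size g
nonterminals≤size []      = z≤n
nonterminals≤size {suc k} (g ▷ r) =
  subst (_≤ size g + ruleSize r) (+-comm k 1) (+-mono-≤ (nonterminals≤size g) (1≤ruleSize r))
  where
  1≤ruleSize : (r : Rule k) → 1 ≤ ruleSize r
  1≤ruleSize (term _)   = s≤s z≤n
  1≤ruleSize (pair _ _) = s≤s z≤n

distinct-framed-factors<size : (g : SLP (suc k)) {c : ℕ} (ws : Fin c → List Sym) →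
  Injective _≡_ _≡_ ws → (∀ t → s$ ∉ ws t) → (∀ t → frame (ws t) ⊑ derived g) → c < size g
distinct-framed-factors<size {k} g {c} ws ws-injective s$∉ws frames⊑ =
  ≤-trans (s≤s (injective⇒≤ nonterminal-injective)) (nonterminals≤size g)
  where
  straddled : ∀ t → Straddled g (frame (ws t))
  straddled t = long-factor⇒straddled g (fromℕ k) (2≤length-frame (ws t)) (frames⊑ t)

  y : Fin c → Fin (suc k)
  y t = proj₁ (straddled t)

  nonterminal : Fin c → Fin k
  nonterminal t = punchOut (zero≢straddled g (straddled t))

  ws≡junction : ∀ t → ws t ≡ junctionWord (lookup (splits g) (y t))
  ws≡junction t = straddling-frame-unique (s$∉ws t) (proj₂ (straddled t))

  nonterminal-injective : Injective _≡_ _≡_ nonterminal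
  nonterminal-injective {t} {t′} eq = ws-injective (begin
    ws t                                   ≡⟨ ws≡junction t ⟩
    junctionWord (lookup (splits g) (y t))  ≡⟨ cong (junctionWord ∘ lookup (splits g)) y-eq ⟩
    junctionWord (lookup (splits g) (y t′)) ≡⟨ sym (ws≡junction t′) ⟩
    ws t′                                  ∎)
    where
    open ≡-Reasoning
    y-eq : y t ≡ y t′
    y-eq = punchOut-injective (zero≢straddled g (straddled t)) (zero≢straddled g (straddled t′)) eq

bitValue : Sym → ℕ
bitValue s1 = 1
bitValue _  = 0

fromBits : List Sym → ℕ
fromBits = foldl (λ acc b → bitValue b + acc * 2) 0

bitValue-bitSym : ∀ {r} → r < 2 → bitValue (bitSym r) ≡ r
bitValue-bitSym {0} _ = refl
bitValue-bitSym {1} _ = refl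
bitValue-bitSym {suc (suc _)} (s≤s (s≤s ()))

fromBits-bits : ∀ m {v} → v < 2 ^ m → fromBits (bits m v) ≡ v
fromBits-bits zero    {zero}  _   = refl
fromBits-bits zero    {suc _} (s≤s ())
fromBits-bits (suc m) {v}    v<2^[1+m] = begin
  fromBits (bits m (v / 2) ++ [ bitSym (v % 2) ])  ≡⟨ foldl-++ _ 0 (bits m (v / 2)) _ ⟩
  bitValue (bitSym (v % 2)) + fromBits (bits m (v / 2)) * 2
    ≡⟨ cong₂ (λ r q → r + q * 2) (bitValue-bitSym (m%n<n v 2)) (fromBits-bits m v/2<2^m) ⟩
  v % 2 + v / 2 * 2                                ≡⟨ sym (m≡m%n+[m/n]*n v 2) ⟩
  v                                                ∎
  where
  open ≡-Reasoning
  v/2<2^m : v / 2 < 2 ^ m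
  v/2<2^m = m<n*o⇒m/o<n (subst (v <_) (*-comm 2 (2 ^ m)) v<2^[1+m])

bits-injective : ∀ m {v v′} → v < 2 ^ m → v′ < 2 ^ m → bits m v ≡ bits m v′ → v ≡ v′
bits-injective m {v} {v′} v< v′< eq = begin
  v                   ≡⟨ sym (fromBits-bits m v<) ⟩
  fromBits (bits m v)  ≡⟨ cong fromBits eq ⟩
  fromBits (bits m v′) ≡⟨ fromBits-bits m v′< ⟩
  v′                  ∎
  where open ≡-Reasoning

s$∉bits : ∀ m v → s$ ∉ bits m v
s$∉bits (suc m) v s$∈ with ∈-++⁻ (bits m (v / 2)) s$∈
... | inj₁ s$∈bits = s$∉bits m (v / 2) s$∈bits
... | inj₂ (here s$≡bit) = bitSym≢s$ (v % 2) (sym s$≡bit)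
  where
  bitSym≢s$ : ∀ r → bitSym r ≢ s$
  bitSym≢s$ zero    ()
  bitSym≢s$ (suc _) ()

shiftBinBlock-diagonal : ∀ n {v} j → v < 2 ^ n → shiftBinBlock n (suc (v + j)) j ≡ binRow n v
shiftBinBlock-diagonal n {v} j v<2^n
  with j <ᵇ suc (v + j)            | <⇒<ᵇ (s≤s (m≤n+m j v))
     | suc (v + j) <ᵇ suc (j + 2 ^ n) | <⇒<ᵇ (s≤s (subst (_< j + 2 ^ n) (+-comm j v) (+-monoʳ-< j v<2^n)))
... | true | _ | true | _ = cong (λ x → binRow n (x ∸ 1)) (m+n∸n≡m (suc v) j)

binRow-⊑-shiftBinRow : ∀ n {v i} → v < 2 ^ n → v < i → i ∸ 2 ^ n ≤ v → binRow n v ⊑ shiftBinRow n i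
binRow-⊑-shiftBinRow n {v} {i} v<2^n v<i i∸2^n≤v =
  subst (λ i → binRow n v ⊑ shiftBinRow n i) i≡
    (subst (_⊑ shiftBinRow n (suc v + j)) (shiftBinBlock-diagonal n j v<2^n)
      (∈⇒⊑-concatMap (shiftBinBlock n (suc v + j)) (∈-upTo⁺ j<2^n)))
  where
  open ≤-Reasoning
  N j : ℕ
  N = 2 ^ n
  j = i ∸ suc v
  i≡ : suc v + j ≡ i
  i≡ = m+[n∸m]≡n v<i
  j<2^n : j < N
  j<2^n = +-cancelˡ-< (suc v) j N (begin-strict
    suc v + j    ≡⟨ i≡ ⟩
    i            ≤⟨ m≤n+m∸n i N ⟩
    N + (i ∸ N)  ≤⟨ +-monoʳ-≤ N i∸2^n≤v ⟩
    N + v        ≡⟨ +-comm N v ⟩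
    v + N        <⟨ n<1+n (v + N) ⟩
    suc v + N    ∎)

row-value< : ∀ {N i t} → i ≤ 2 * N → t < i ⊓ (2 * N ∸ i) → (i ∸ N) + t < i ⊓ N
row-value< {N} {i} {t} i≤2N t<c with ≤-total i N
... | inj₁ i≤N = begin-strict
  (i ∸ N) + t  ≡⟨ cong (_+ t) (m≤n⇒m∸n≡0 i≤N) ⟩
  t            <⟨ <-≤-trans t<c (m⊓n≤m i _) ⟩
  i            ≡⟨ sym (m≤n⇒m⊓n≡m i≤N) ⟩
  i ⊓ N        ∎
  where open ≤-Reasoning
... | inj₂ N≤i = subst ((i ∸ N) + t <_) (sym (m≥n⇒m⊓n≡n N≤i)) (+-cancelʳ-≤ N _ N (begin
  suc ((i ∸ N) + t) + N  ≡⟨ cong (λ x → suc x + N) (+-comm (i ∸ N) t) ⟩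
  suc (t + (i ∸ N)) + N  ≡⟨ +-assoc (suc t) (i ∸ N) N ⟩
  suc t + ((i ∸ N) + N)  ≡⟨ cong (suc t +_) (m∸n+n≡m N≤i) ⟩
  suc t + i              ≤⟨ m≤o∸n⇒m+n≤o (suc t) i≤2N (<-≤-trans t<c (m⊓n≤n i _)) ⟩
  2 * N                  ≡⟨ cong (N +_) (+-identityʳ N) ⟩
  N + N                  ∎))
  where open ≤-Reasoning

lemma4p4 : (n : ℕ) → 1 ≤ n → (i : ℕ) → 1 ≤ i → i ≤ 2 * 2 ^ n →
    (m : ℕ) (g : SLP (suc m)) → shiftBinRow n i ⊑ derived g →
    i ⊓ (2 * 2 ^ n + 1 ∸ i) ≤ size g
lemma4p4 n _ i _ i≤2N m g row⊑derived = begin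
  i ⊓ (2 * N + 1 ∸ i)  ≤⟨ ⊓-mono-≤ (n≤1+n i) (≤-reflexive (trans (+-∸-comm 1 i≤2N) (+-comm _ 1))) ⟩
  suc c                ≤⟨ distinct-framed-factors<size g ws ws-injective (s$∉bits n ∘ v) frame⊑derived ⟩
  size g               ∎
  where
  open ≤-Reasoning
  N c : ℕ
  N = 2 ^ n
  c = i ⊓ (2 * N ∸ i)

  v : Fin c → ℕ
  v t = (i ∸ N) + toℕ t

  v<i⊓N : ∀ t → v t < i ⊓ N
  v<i⊓N t = row-value< i≤2N (toℕ<n t)

  v<N : ∀ t → v t < N
  v<N t = <-≤-trans (v<i⊓N t) (m⊓n≤n i N)

  ws : Fin c → List Sym
  ws t = bits n (v t)

  ws-injective : Injective _≡_ _≡_ ws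
  ws-injective {t} {t′} eq = toℕ-injective (+-cancelˡ-≡ (i ∸ N) _ _ (bits-injective n (v<N t) (v<N t′) eq))

  frame⊑derived : ∀ t → frame (ws t) ⊑ derived g
  frame⊑derived t = ⊑-trans
    (binRow-⊑-shiftBinRow n (v<N t) (<-≤-trans (v<i⊓N t) (m⊓n≤m i N)) (m≤m+n (i ∸ N) (toℕ t)))
    row⊑derived
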